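{- Let $n\ge1$ be an integer and $c_1,c_2\in\mathbb{Z}_{\ge0}$. Then $$\sum_{j_1,\dots,j_n=0}^{\infty}\ \prod_{k=1}^{n}\,(c_1+j_1+\dots+j_k)\left(\frac{c_2+k-1}{c_2+n}\right)^{j_k}=\frac{(c_2+n)^n}{n!}\prod_{k=1}^{n}(c_1+c_2+k-1)$$ (with the convention $0^0=1$). -}

module Defs where

open import Data.Nat as ℕ using (ℕ; zero; suc)
open import Data.Nat using (_!)
open import Data.Nat.ListAction using (product)
open import Data.Integer using (+_)
open import Data.Rational using (ℚ; _/_; 0ℚ; 1ℚ; _*_; _+_)
open import Data.List using (List; []; _∷_; map; concatMap; upTo; foldr)
import Data.List as L
open import Data.Vec using (Vec; []; _∷_)

-- the rational number a / d  (only used with d ≥ 1; value 0 for d = 0 is an irrelevant junk value)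
qdiv : ℕ → ℕ → ℚ
qdiv a zero    = 0ℚ
qdiv a (suc d) = + a / suc d

_^ℚ_ : ℚ → ℕ → ℚ
x ^ℚ zero  = 1ℚ
x ^ℚ suc m = x * (x ^ℚ m)

sumℚ : List ℚ → ℚ
sumℚ = foldr _+_ 0ℚ

box : (m M : ℕ) → List (Vec ℕ m)
box zero    M = [] ∷ []
box (suc m) M = concatMap (λ j → map (j ∷_) (box m M)) (upTo (suc M))

-- termAux c₂ n a i (j_{i+1},…,j_n), with a = c₁ + j₁ + … + j_i:
--   ∏_{k=i+1}^{n} (c₁+j₁+…+j_k) ((c₂+k-1)/(c₂+n))^{j_k}
termAux : (c₂ n : ℕ) → (a i : ℕ) → {m : ℕ} → Vec ℕ m → ℚ
termAux c₂ n a i []       = 1ℚ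
termAux c₂ n a i (j ∷ js) =
  (+ (a ℕ.+ j) / 1) * (qdiv (c₂ ℕ.+ i) (c₂ ℕ.+ n) ^ℚ j) * termAux c₂ n (a ℕ.+ j) (suc i) js

term : (n c₁ c₂ : ℕ) → Vec ℕ n → ℚ
term n c₁ c₂ js = termAux c₂ n c₁ 0 js

partialSum : (n c₁ c₂ M : ℕ) → ℚ
partialSum n c₁ c₂ M = sumℚ (map (term n c₁ c₂) (box n M))

rhs : (n c₁ c₂ : ℕ) → ℚ
rhs n c₁ c₂ =
  qdiv ((c₂ ℕ.+ n) ℕ.^ n ℕ.* product (map (λ k → c₁ ℕ.+ c₂ ℕ.+ k) (upTo n))) (n !)

module Submission where

-- Write D = c₂ + n and y_i = (c₂ + i) / D. Summing out j_n, j_{n-1}, … in turn, the inner sum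
-- over j_{i+1}, …, j_n with c₁ + j₁ + … + j_i = t equals
--   G_i(t) = D^(n-i) · t′ (t′ + 1) ⋯ (t′ + n - i - 1) / (n - i)!,   t′ = t + c₂ + i,
-- because G_i(t) = t · G_{i+1}(t) + y_i · G_i(t + 1) telescopes into the sum over j_{i+1}.
-- At i = 0, t = c₁ this is the right-hand side. Truncating every j_k at M only drops
-- nonnegative terms, and by induction on n - i it loses at most z^(M+1) times a polynomial in M,
-- where z = y_{n-1} = (D - 1)/D. Finally (D - 1)^k k^e / D^k → 0, since the binomial theorem gives
-- (k + 1)^(e+1) (D - 1)^k ≤ (e + 1)! D^(k+e+1).

open import Data.Nat as ℕ using (ℕ; zero; suc; _!; _∸_; NonZero; z≤n; s≤s)
import Data.Nat.Properties as ℕP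
open import Data.Nat.Tactic.RingSolver using (solve-∀)
open import Data.Product using (∃-syntax; _,_; proj₁; proj₂)
open import Relation.Binary.PropositionalEquality
open import Data.List using (applyUpTo)
open import Data.Nat.ListAction using (product)
open import Function using (_∘_)

-- Estimates in ℕ

module _ where
  open import Data.Nat using (_+_; _*_; _^_; _≤_; _<_)
  open ℕP.≤-Reasoning

  ^-distribʳ-* : ∀ a b e → (a * b) ^ e ≡ a ^ e * b ^ e
  ^-distribʳ-* a b zero    = refl
  ^-distribʳ-* a b (suc e) = trans (cong (a * b *_) (^-distribʳ-* a b e)) (interchange a b (a ^ e) (b ^ e))
    where
    interchange : ∀ a b x y → a * b * (x * y) ≡ a * x * (b * y)
    interchange = solve-∀

  -- pascal k r = C(k + r, r)
  pascal : ℕ → ℕ → ℕ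
  pascal zero    r       = 1
  pascal (suc k) zero    = 1
  pascal (suc k) (suc r) = pascal k (suc r) + pascal (suc k) r

  pascal-zeroʳ : ∀ k → pascal k 0 ≡ 1
  pascal-zeroʳ zero    = refl
  pascal-zeroʳ (suc k) = refl

  pascal-absorption : ∀ k r → suc r * pascal k (suc r) ≡ suc (k + r) * pascal k r
  pascal-absorption zero    r       = refl
  pascal-absorption (suc k) zero    = begin-equality
    1 * (pascal k 1 + 1)         ≡⟨ distrib (pascal k 1) ⟩
    1 * pascal k 1 + 1           ≡⟨ cong (_+ 1) (pascal-absorption k 0) ⟩
    suc (k + 0) * pascal k 0 + 1 ≡⟨ cong (λ x → suc (k + 0) * x + 1) (pascal-zeroʳ k) ⟩
    suc (k + 0) * 1 + 1          ≡⟨ arith k ⟩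
    suc (suc k + 0) * 1          ∎
    where
    distrib : ∀ x → 1 * (x + 1) ≡ 1 * x + 1
    distrib = solve-∀
    arith : ∀ k → suc (k + 0) * 1 + 1 ≡ suc (suc k + 0) * 1
    arith = solve-∀
  pascal-absorption (suc k) (suc r) = begin-equality
    suc (suc r) * (A + (B + C))                                ≡⟨ split r A B C ⟩
    suc (suc r) * A + suc r * (B + C) + (B + C)                ≡⟨ cong₂ (λ x y → x + y + (B + C)) (pascal-absorption k (suc r)) (pascal-absorption (suc k) r) ⟩
    suc (k + suc r) * B + suc (suc k + r) * C + (B + C)        ≡⟨ merge k r B C ⟩
    suc (suc k + suc r) * (B + C)                              ∎
    where
    A = pascal k (suc (suc r))
    B = pascal k (suc r)
    C = pascal (suc k) r
    split : ∀ r A B C → suc (suc r) * (A + (B + C)) ≡ suc (suc r) * A + suc r * (B + C) + (B + C)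
    split = solve-∀
    merge : ∀ k r B C → suc (k + suc r) * B + suc (suc k + r) * C + (B + C) ≡ suc (suc k + suc r) * (B + C)
    merge = solve-∀

  suc^≤!*pascal : ∀ k r → suc k ^ r ≤ r ! * pascal k r
  suc^≤!*pascal k zero    = ℕP.≤-reflexive (sym (trans (ℕP.*-identityˡ _) (pascal-zeroʳ k)))
  suc^≤!*pascal k (suc r) = begin
    suc k * suc k ^ r              ≤⟨ ℕP.*-monoʳ-≤ (suc k) (suc^≤!*pascal k r) ⟩
    suc k * (r ! * pascal k r)     ≤⟨ ℕP.*-monoˡ-≤ (r ! * pascal k r) (s≤s (ℕP.m≤m+n k r)) ⟩
    suc (k + r) * (r ! * pascal k r) ≡⟨ swap (suc (k + r)) (r !) (pascal k r) ⟩
    r ! * (suc (k + r) * pascal k r) ≡⟨ cong (r ! *_) (sym (pascal-absorption k r)) ⟩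
    r ! * (suc r * pascal k (suc r)) ≡⟨ reassoc (r !) (suc r) (pascal k (suc r)) ⟩
    (suc r * r !) * pascal k (suc r) ∎
    where
    swap : ∀ a b c → a * (b * c) ≡ b * (a * c)
    swap = solve-∀
    reassoc : ∀ a b c → a * (b * c) ≡ (b * a) * c
    reassoc = solve-∀

  pascal*^≤suc^ : ∀ d k r → pascal k r * d ^ k ≤ suc d ^ (k + r)
  pascal*^≤suc^ d zero    r       = ℕP.^-monoʳ-≤ (suc d) {0} {r} z≤n
  pascal*^≤suc^ d (suc k) zero    = begin
    1 * d ^ suc k        ≡⟨ ℕP.*-identityˡ _ ⟩
    d ^ suc k            ≤⟨ ℕP.^-monoˡ-≤ (suc k) (ℕP.n≤1+n d) ⟩
    suc d ^ suc k        ≡⟨ cong (suc d ^_) (sym (ℕP.+-identityʳ (suc k))) ⟩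
    suc d ^ (suc k + 0)  ∎
  pascal*^≤suc^ d (suc k) (suc r) = begin
    (pascal k (suc r) + pascal (suc k) r) * (d * d ^ k)
      ≡⟨ distrib (pascal k (suc r)) (pascal (suc k) r) d (d ^ k) ⟩
    d * (pascal k (suc r) * d ^ k) + pascal (suc k) r * d ^ suc k
      ≤⟨ ℕP.+-mono-≤ (ℕP.*-monoʳ-≤ d (pascal*^≤suc^ d k (suc r))) (pascal*^≤suc^ d (suc k) r) ⟩
    d * suc d ^ (k + suc r) + suc d ^ (suc k + r)
      ≡⟨ cong (λ x → d * suc d ^ x + suc d ^ (suc k + r)) (ℕP.+-suc k r) ⟩
    d * suc d ^ (suc k + r) + suc d ^ (suc k + r)
      ≡⟨ collect d (suc d ^ (suc k + r)) ⟩
    suc d ^ suc (suc k + r)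
      ≡⟨ cong (suc d ^_) (sym (ℕP.+-suc (suc k) r)) ⟩
    suc d ^ (suc k + suc r) ∎
    where
    distrib : ∀ a b d x → (a + b) * (d * x) ≡ d * (a * x) + b * (d * x)
    distrib = solve-∀
    collect : ∀ d x → d * x + x ≡ suc d * x
    collect = solve-∀

  binomial-lower-bound : ∀ d k r → suc k ^ r * d ^ k ≤ r ! * suc d ^ (k + r)
  binomial-lower-bound d k r = begin
    suc k ^ r * d ^ k              ≤⟨ ℕP.*-monoˡ-≤ (d ^ k) (suc^≤!*pascal k r) ⟩
    r ! * pascal k r * d ^ k       ≡⟨ ℕP.*-assoc (r !) (pascal k r) (d ^ k) ⟩
    r ! * (pascal k r * d ^ k)     ≤⟨ ℕP.*-monoʳ-≤ (r !) (pascal*^≤suc^ d k r) ⟩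
    r ! * suc d ^ (k + r)          ∎

  ^-dominates-poly : ∀ d C e p q →
    ∃[ N ] (∀ k → N ≤ k → d ^ k * (C * k ^ e) * suc q < suc p * suc d ^ k)
  ^-dominates-poly zero C e p q = 1 , λ where
    (suc k) _ → ℕP.<-≤-trans (ℕP.m^n>0 1 (suc k)) (ℕP.m≤n*m (1 ^ suc k) (suc p))
  ^-dominates-poly d@(suc _) C e p q = r + A , λ k r+A≤k →
    subst (λ k → d ^ k * (C * k ^ e) * suc q < suc p * suc d ^ k)
          (ℕP.m∸n+n≡m (ℕP.≤-trans (ℕP.m≤m+n r A) r+A≤k))
          (beyond (k ∸ r) (ℕP.≤-trans (ℕP.≤-reflexive (sym (ℕP.m+n∸m≡n r A))) (ℕP.∸-monoˡ-≤ r r+A≤k)))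
    where
    r = suc e
    A = suc q * C * r ^ e * d ^ r * r !
    -- after multiplying by r!, the factor k + 1 > A absorbs all constants
    beyond : ∀ k → A ≤ k → d ^ (k + r) * (C * (k + r) ^ e) * suc q < suc p * suc d ^ (k + r)
    beyond k A≤k = ℕP.*-cancelˡ-< (r !) _ _ (begin-strict
      r ! * (d ^ (k + r) * (C * (k + r) ^ e) * suc q)
        ≤⟨ ℕP.*-monoʳ-≤ (r !) (ℕP.*-monoˡ-≤ (suc q) (ℕP.*-monoʳ-≤ (d ^ (k + r))
             (ℕP.*-monoʳ-≤ C (ℕP.^-monoˡ-≤ e k+r≤r*[1+k])))) ⟩
      r ! * (d ^ (k + r) * (C * (r * suc k) ^ e) * suc q)
        ≡⟨ cong₂ (λ x y → r ! * (x * (C * y) * suc q)) (ℕP.^-distribˡ-+-* d k r) (^-distribʳ-* r (suc k) e) ⟩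
      r ! * (d ^ k * d ^ r * (C * (r ^ e * suc k ^ e)) * suc q)
        ≡⟨ regroup (r !) (d ^ k) (d ^ r) C (r ^ e) (suc k ^ e) (suc q) ⟩
      A * (suc k ^ e * d ^ k)
        <⟨ ℕP.*-monoˡ-< (suc k ^ e * d ^ k) {{ℕP.m*n≢0 _ _ {{ℕP.m^n≢0 (suc k) e}} {{ℕP.m^n≢0 d k}}}} (s≤s A≤k) ⟩
      suc k * (suc k ^ e * d ^ k)
        ≡⟨ sym (ℕP.*-assoc (suc k) (suc k ^ e) (d ^ k)) ⟩
      suc k ^ r * d ^ k
        ≤⟨ binomial-lower-bound d k r ⟩
      r ! * suc d ^ (k + r)
        ≤⟨ ℕP.*-monoʳ-≤ (r !) (ℕP.m≤n*m (suc d ^ (k + r)) (suc p)) ⟩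
      r ! * (suc p * suc d ^ (k + r)) ∎)
      where
      k+r≤r*[1+k] : k + r ≤ r * suc k
      k+r≤r*[1+k] = ℕP.≤-trans (ℕP.≤-reflexive (ℕP.+-comm k r))
        (ℕP.≤-trans (ℕP.+-monoʳ-≤ r (ℕP.m≤n*m k r)) (ℕP.≤-reflexive (sym (ℕP.*-suc r k))))
      regroup : ∀ f a b c g h q → f * (a * b * (c * (g * h)) * q) ≡ q * c * g * b * f * (h * a)
      regroup = solve-∀

  rising : ℕ → ℕ → ℕ
  rising zero    x = 1
  rising (suc m) x = x * rising m (suc x)

  rising-sucˡ : ∀ m x → rising (suc m) x ≡ rising m x * (x + m)
  rising-sucˡ zero    x = trans (ℕP.*-identityʳ x) (sym (trans (ℕP.*-identityˡ (x + 0)) (ℕP.+-identityʳ x)))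
  rising-sucˡ (suc m) x = begin-equality
    x * rising (suc m) (suc x)              ≡⟨ cong (x *_) (rising-sucˡ m (suc x)) ⟩
    x * (rising m (suc x) * (suc x + m))    ≡⟨ cong (λ y → x * (rising m (suc x) * y)) (sym (ℕP.+-suc x m)) ⟩
    x * (rising m (suc x) * (x + suc m))    ≡⟨ ℕP.*-assoc x _ _ ⟨
    x * rising m (suc x) * (x + suc m)      ∎

  rising≤^ : ∀ m x → rising m x ≤ (x + m) ^ m
  rising≤^ zero    x = ℕP.≤-refl
  rising≤^ (suc m) x = ℕP.*-mono-≤ (ℕP.m≤m+n x (suc m))
    (ℕP.≤-trans (rising≤^ m (suc x)) (ℕP.≤-reflexive (cong (_^ m) (sym (ℕP.+-suc x m)))))

  product-applyUpTo≡rising : ∀ m x (f : ℕ → ℕ) → (∀ k → f k ≡ x + k) → product (applyUpTo f m) ≡ rising m x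
  product-applyUpTo≡rising zero    x f f≗x+ = refl
  product-applyUpTo≡rising (suc m) x f f≗x+ = cong₂ _*_ (trans (f≗x+ 0) (ℕP.+-identityʳ x))
    (product-applyUpTo≡rising m (suc x) (f ∘ suc) (λ k → trans (f≗x+ (suc k)) (ℕP.+-suc x k)))

  ^-absorb-step : ∀ D V K m → 1 ≤ D → D ≤ V → K ≤ V → 2 ≤ V →
    (D * V) ^ suc m + K * (V * (D * V) ^ (3 * m)) ≤ (D * V) ^ (3 * suc m)
  ^-absorb-step D V K m 1≤D D≤V K≤V 2≤V = begin
    D * V * (D * V) ^ m + K * (V * X)
      ≤⟨ ℕP.+-mono-≤ (ℕP.*-mono-≤ (ℕP.*-monoˡ-≤ V D≤V) (ℕP.^-monoʳ-≤ (D * V) {{DV≢0}} (ℕP.m≤n*m m 3)))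
                     (ℕP.*-monoˡ-≤ (V * X) K≤V) ⟩
    V * V * X + V * (V * X)        ≡⟨ double V X ⟩
    2 * (V * V * X)                ≤⟨ ℕP.*-monoˡ-≤ (V * V * X) 2≤V ⟩
    V * (V * V * X)                ≡⟨ unit V X ⟩
    1 * 1 * 1 * (V * V * V) * X    ≤⟨ ℕP.*-monoˡ-≤ X (ℕP.*-monoˡ-≤ (V * V * V) (ℕP.*-mono-≤ (ℕP.*-mono-≤ 1≤D 1≤D) 1≤D)) ⟩
    D * D * D * (V * V * V) * X    ≡⟨ cong (_* X) (cube D V) ⟩
    (D * V) ^ 3 * X                ≡⟨ ℕP.^-distribˡ-+-* (D * V) 3 (3 * m) ⟨
    (D * V) ^ (3 + 3 * m)          ≡⟨ cong ((D * V) ^_) (ℕP.*-suc 3 m) ⟨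
    (D * V) ^ (3 * suc m)          ∎
    where
    X = (D * V) ^ (3 * m)
    DV≢0 : NonZero (D * V)
    DV≢0 = ℕ.>-nonZero (ℕP.*-mono-≤ 1≤D (ℕP.≤-trans 1≤D D≤V))
    double : ∀ V X → V * V * X + V * (V * X) ≡ 2 * (V * V * X)
    double = solve-∀
    unit : ∀ V X → V * (V * V * X) ≡ 1 * 1 * 1 * (V * V * V) * X
    unit = solve-∀
    cube : ∀ D V → D * D * D * (V * V * V) ≡ (D * V) * ((D * V) * ((D * V) * 1))
    cube = solve-∀

-- Natural numbers inside ℚ

open import Data.Integer as ℤ using (+_; -[1+_])
import Data.Integer.Properties as ℤP
import Data.Integer.Solver
open import Data.Rational as ℚ using (ℚ; mkℚ; 0ℚ; 1ℚ; _+_; _*_; _-_; -_; _≤_; _<_; ∣_∣; toℚᵘ)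
import Data.Rational.Properties as ℚP
import Data.Rational.Solver
open import Data.Rational.Unnormalised as ℚᵘ using (mkℚᵘ; *≡*; *≤*; *<*)
import Data.Rational.Unnormalised.Properties as ℚᵘP
open import Data.List using (List; []; _∷_; _++_; map; concat)
import Data.List.Properties as ListP
open import Data.Vec using (Vec; _∷_)
open import Defs

module ℤS = Data.Integer.Solver.+-*-Solver
module ℚS = Data.Rational.Solver.+-*-Solver

fromℕ : ℕ → ℚ
fromℕ a = qdiv a 1

-- recip 0 = 0, the junk value of qdiv.
recip : ℕ → ℚ
recip d = qdiv 1 d

toℚᵘ-qdiv : ∀ a d → toℚᵘ (qdiv a (suc d)) ℚᵘ.≃ mkℚᵘ (+ a) d
toℚᵘ-qdiv a d = ℚP.toℚᵘ-fromℚᵘ (mkℚᵘ (+ a) d)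

fromℕ-+ : ∀ a b → fromℕ (a ℕ.+ b) ≡ fromℕ a + fromℕ b
fromℕ-+ a b = ℚP.toℚᵘ-injective (begin
  toℚᵘ (fromℕ (a ℕ.+ b))                  ≈⟨ toℚᵘ-qdiv (a ℕ.+ b) 0 ⟩
  mkℚᵘ (+ (a ℕ.+ b)) 0                    ≈⟨ *≡* (trans (cong (ℤ._* + 1) (ℤP.pos-+ a b)) (identity (+ a) (+ b))) ⟩
  mkℚᵘ (+ a) 0 ℚᵘ.+ mkℚᵘ (+ b) 0          ≈⟨ ℚᵘP.+-cong (toℚᵘ-qdiv a 0) (toℚᵘ-qdiv b 0) ⟨
  toℚᵘ (fromℕ a) ℚᵘ.+ toℚᵘ (fromℕ b)      ≈⟨ ℚP.toℚᵘ-homo-+ (fromℕ a) (fromℕ b) ⟨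
  toℚᵘ (fromℕ a + fromℕ b)                ∎)
  where
  open ℚᵘP.≃-Reasoning
  open ℤS
  identity : ∀ x y → (x ℤ.+ y) ℤ.* + 1 ≡ (x ℤ.* + 1 ℤ.+ y ℤ.* + 1) ℤ.* + 1
  identity = solve 2 (λ x y → (x :+ y) :* con (+ 1) := (x :* con (+ 1) :+ y :* con (+ 1)) :* con (+ 1)) refl

fromℕ-* : ∀ a b → fromℕ (a ℕ.* b) ≡ fromℕ a * fromℕ b
fromℕ-* a b = ℚP.toℚᵘ-injective (begin
  toℚᵘ (fromℕ (a ℕ.* b))                  ≈⟨ toℚᵘ-qdiv (a ℕ.* b) 0 ⟩
  mkℚᵘ (+ (a ℕ.* b)) 0                    ≈⟨ *≡* (cong (ℤ._* + 1) (ℤP.pos-* a b)) ⟩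
  mkℚᵘ (+ a) 0 ℚᵘ.* mkℚᵘ (+ b) 0          ≈⟨ ℚᵘP.*-cong (toℚᵘ-qdiv a 0) (toℚᵘ-qdiv b 0) ⟨
  toℚᵘ (fromℕ a) ℚᵘ.* toℚᵘ (fromℕ b)      ≈⟨ ℚP.toℚᵘ-homo-* (fromℕ a) (fromℕ b) ⟨
  toℚᵘ (fromℕ a * fromℕ b)                ∎)
  where open ℚᵘP.≃-Reasoning

qdiv*fromℕ : ∀ a d → qdiv a (suc d) * fromℕ (suc d) ≡ fromℕ a
qdiv*fromℕ a d = ℚP.toℚᵘ-injective (begin
  toℚᵘ (qdiv a (suc d) * fromℕ (suc d))            ≈⟨ ℚP.toℚᵘ-homo-* (qdiv a (suc d)) (fromℕ (suc d)) ⟩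
  toℚᵘ (qdiv a (suc d)) ℚᵘ.* toℚᵘ (fromℕ (suc d))  ≈⟨ ℚᵘP.*-cong (toℚᵘ-qdiv a d) (toℚᵘ-qdiv (suc d) 0) ⟩
  mkℚᵘ (+ a) d ℚᵘ.* mkℚᵘ (+ suc d) 0               ≈⟨ *≡* (cross (+ a) (+ suc d)) ⟩
  mkℚᵘ (+ a) 0                                      ≈⟨ toℚᵘ-qdiv a 0 ⟨
  toℚᵘ (fromℕ a)                                    ∎)
  where
  open ℚᵘP.≃-Reasoning
  open ℤS
  cross : ∀ x y → (x ℤ.* y) ℤ.* + 1 ≡ x ℤ.* (y ℤ.* + 1)
  cross = solve 2 (λ x y → (x :* y) :* con (+ 1) := x :* (y :* con (+ 1))) refl

recip*fromℕ : ∀ d → recip (suc d) * fromℕ (suc d) ≡ 1ℚ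
recip*fromℕ d = qdiv*fromℕ 1 d

qdiv≡fromℕ*recip : ∀ a d → qdiv a d ≡ fromℕ a * recip d
qdiv≡fromℕ*recip a zero    = sym (ℚP.*-zeroʳ (fromℕ a))
qdiv≡fromℕ*recip a (suc d) = begin
  qdiv a (suc d)                                      ≡⟨ ℚP.*-identityʳ (qdiv a (suc d)) ⟨
  qdiv a (suc d) * 1ℚ                                 ≡⟨ cong (qdiv a (suc d) *_) (trans (ℚP.*-comm (fromℕ (suc d)) (recip (suc d))) (recip*fromℕ d)) ⟨
  qdiv a (suc d) * (fromℕ (suc d) * recip (suc d))    ≡⟨ ℚP.*-assoc (qdiv a (suc d)) (fromℕ (suc d)) (recip (suc d)) ⟨
  qdiv a (suc d) * fromℕ (suc d) * recip (suc d)      ≡⟨ cong (_* recip (suc d)) (qdiv*fromℕ a d) ⟩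
  fromℕ a * recip (suc d)                             ∎
  where open ≡-Reasoning

inverse-unique : ∀ x y c → x * c ≡ 1ℚ → y * c ≡ 1ℚ → x ≡ y
inverse-unique x y c x*c≡1 y*c≡1 = begin
  x                ≡⟨ ℚP.*-identityʳ x ⟨
  x * 1ℚ           ≡⟨ cong (x *_) (trans (ℚP.*-comm c y) y*c≡1) ⟨
  x * (c * y)      ≡⟨ ℚP.*-assoc x c y ⟨
  x * c * y        ≡⟨ cong (_* y) x*c≡1 ⟩
  1ℚ * y           ≡⟨ ℚP.*-identityˡ y ⟩
  y                ∎
  where open ≡-Reasoning

recip-* : ∀ a b → recip (a ℕ.* b) ≡ recip a * recip b
recip-* zero    b       = sym (ℚP.*-zeroˡ (recip b))
recip-* (suc a) zero    rewrite ℕP.*-zeroʳ a = sym (ℚP.*-zeroʳ (recip (suc a)))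
recip-* (suc a) (suc b) =
  inverse-unique _ _ (fromℕ (suc a ℕ.* suc b)) (recip*fromℕ (b ℕ.+ a ℕ.* suc b)) (begin
    recip (suc a) * recip (suc b) * fromℕ (suc a ℕ.* suc b)
      ≡⟨ cong (recip (suc a) * recip (suc b) *_) (fromℕ-* (suc a) (suc b)) ⟩
    recip (suc a) * recip (suc b) * (fromℕ (suc a) * fromℕ (suc b))
      ≡⟨ interchange (recip (suc a)) (recip (suc b)) (fromℕ (suc a)) (fromℕ (suc b)) ⟩
    recip (suc a) * fromℕ (suc a) * (recip (suc b) * fromℕ (suc b))
      ≡⟨ cong₂ _*_ (recip*fromℕ a) (recip*fromℕ b) ⟩
    1ℚ * 1ℚ
      ∎)
  where
  open ≡-Reasoning
  open ℚS
  interchange : ∀ p q r s → p * q * (r * s) ≡ p * r * (q * s)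
  interchange = solve 4 (λ p q r s → p :* q :* (r :* s) := p :* r :* (q :* s)) refl

fromℕ*recip : ∀ d → fromℕ (suc d) * recip (suc d) ≡ 1ℚ
fromℕ*recip d = trans (ℚP.*-comm (fromℕ (suc d)) (recip (suc d))) (recip*fromℕ d)

recip-! : ∀ m → recip (m !) ≡ fromℕ (suc m) * recip (suc m !)
recip-! m = begin
  recip (m !)                                        ≡⟨ ℚP.*-identityˡ (recip (m !)) ⟨
  1ℚ * recip (m !)                                   ≡⟨ cong (_* recip (m !)) (fromℕ*recip m) ⟨
  fromℕ (suc m) * recip (suc m) * recip (m !)        ≡⟨ ℚP.*-assoc (fromℕ (suc m)) (recip (suc m)) (recip (m !)) ⟩
  fromℕ (suc m) * (recip (suc m) * recip (m !))      ≡⟨ cong (fromℕ (suc m) *_) (recip-* (suc m) (m !)) ⟨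
  fromℕ (suc m) * recip (suc m !)                    ∎
  where open ≡-Reasoning

fromℕ-^ : ∀ a k → fromℕ (a ℕ.^ k) ≡ fromℕ a ^ℚ k
fromℕ-^ a zero    = refl
fromℕ-^ a (suc k) = trans (fromℕ-* a (a ℕ.^ k)) (cong (fromℕ a *_) (fromℕ-^ a k))

recip-^ : ∀ a k → recip (a ℕ.^ k) ≡ recip a ^ℚ k
recip-^ a zero    = refl
recip-^ a (suc k) = trans (recip-* a (a ℕ.^ k)) (cong (recip a *_) (recip-^ a k))

^ℚ-distrib-* : ∀ x y k → (x * y) ^ℚ k ≡ x ^ℚ k * y ^ℚ k
^ℚ-distrib-* x y zero    = sym (ℚP.*-identityˡ 1ℚ)
^ℚ-distrib-* x y (suc k) = trans (cong (x * y *_) (^ℚ-distrib-* x y k)) (interchange x y (x ^ℚ k) (y ^ℚ k))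
  where
  open ℚS
  interchange : ∀ p q r s → p * q * (r * s) ≡ p * r * (q * s)
  interchange = solve 4 (λ p q r s → p :* q :* (r :* s) := p :* r :* (q :* s)) refl

fromℕ-mono-≤ : ∀ {a b} → a ℕ.≤ b → fromℕ a ≤ fromℕ b
fromℕ-mono-≤ {a} {b} a≤b = ℚP.toℚᵘ-cancel-≤ (begin
  toℚᵘ (fromℕ a)   ≃⟨ toℚᵘ-qdiv a 0 ⟩
  mkℚᵘ (+ a) 0     ≤⟨ *≤* (ℤP.*-monoʳ-≤-nonNeg (+ 1) (ℤ.+≤+ a≤b)) ⟩
  mkℚᵘ (+ b) 0     ≃⟨ toℚᵘ-qdiv b 0 ⟨
  toℚᵘ (fromℕ b)   ∎)
  where open ℚᵘP.≤-Reasoning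

fromℕ-nonNeg : ∀ a → 0ℚ ≤ fromℕ a
fromℕ-nonNeg a = fromℕ-mono-≤ {0} {a} z≤n

recip-nonNeg : ∀ d → 0ℚ ≤ recip d
recip-nonNeg zero    = ℚP.≤-refl
recip-nonNeg (suc d) = ℚP.toℚᵘ-cancel-≤ (ℚᵘP.≤-respʳ-≃ (ℚᵘP.≃-sym (toℚᵘ-qdiv 1 d)) (*≤* (ℤ.+≤+ z≤n)))

recip-≤1 : ∀ d → recip d ≤ 1ℚ
recip-≤1 zero    = ℚP.toℚᵘ-cancel-≤ (*≤* (ℤ.+≤+ z≤n))
recip-≤1 (suc d) = ℚP.toℚᵘ-cancel-≤ (ℚᵘP.≤-respˡ-≃ (ℚᵘP.≃-sym (toℚᵘ-qdiv 1 d)) (*≤* (ℤ.+≤+ (s≤s z≤n))))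

qdiv-<-qdiv : ∀ a b c d → 1 ℕ.≤ b → a ℕ.* suc d ℕ.< c ℕ.* b → qdiv a b < qdiv c (suc d)
qdiv-<-qdiv a (suc b) c d _ ad<cb = ℚP.toℚᵘ-cancel-< (begin-strict
  toℚᵘ (qdiv a (suc b))   ≃⟨ toℚᵘ-qdiv a b ⟩
  mkℚᵘ (+ a) b            <⟨ *<* (subst₂ ℤ._<_ (ℤP.pos-* a (suc d)) (ℤP.pos-* c (suc b)) (ℤ.+<+ ad<cb)) ⟩
  mkℚᵘ (+ c) d            ≃⟨ toℚᵘ-qdiv c d ⟨
  toℚᵘ (qdiv c (suc d))   ∎)
  where open ℚᵘP.≤-Reasoning

p≤p+q : ∀ {p q} → 0ℚ ≤ q → p ≤ p + q
p≤p+q {p} 0≤q = ℚP.≤-trans (ℚP.≤-reflexive (sym (ℚP.+-identityʳ p))) (ℚP.+-monoʳ-≤ p 0≤q)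

*-nonNeg : ∀ {x y} → 0ℚ ≤ x → 0ℚ ≤ y → 0ℚ ≤ x * y
*-nonNeg {x} {y} 0≤x 0≤y =
  ℚP.nonNegative⁻¹ (x * y) {{ℚP.nonNeg*nonNeg⇒nonNeg x {{ℚ.nonNegative 0≤x}} y {{ℚ.nonNegative 0≤y}}}}

*-monoˡ-≤-0≤ : ∀ {c x y} → 0ℚ ≤ c → x ≤ y → c * x ≤ c * y
*-monoˡ-≤-0≤ {c} 0≤c = ℚP.*-monoˡ-≤-nonNeg c {{ℚ.nonNegative 0≤c}}

*-monoʳ-≤-0≤ : ∀ {c x y} → 0ℚ ≤ c → x ≤ y → x * c ≤ y * c
*-monoʳ-≤-0≤ {c} 0≤c = ℚP.*-monoʳ-≤-nonNeg c {{ℚ.nonNegative 0≤c}}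

*-mono-≤-0≤ : ∀ {x x′ y y′} → 0ℚ ≤ x → 0ℚ ≤ y → x ≤ x′ → y ≤ y′ → x * y ≤ x′ * y′
*-mono-≤-0≤ 0≤x 0≤y x≤x′ y≤y′ = ℚP.≤-trans (*-monoʳ-≤-0≤ 0≤y x≤x′) (*-monoˡ-≤-0≤ (ℚP.≤-trans 0≤x x≤x′) y≤y′)

^ℚ-nonNeg : ∀ {x} k → 0ℚ ≤ x → 0ℚ ≤ x ^ℚ k
^ℚ-nonNeg zero    0≤x = ℚP.toℚᵘ-cancel-≤ (*≤* (ℤ.+≤+ z≤n))
^ℚ-nonNeg (suc k) 0≤x = *-nonNeg 0≤x (^ℚ-nonNeg k 0≤x)

^ℚ-monoˡ-≤ : ∀ {x y} k → 0ℚ ≤ x → x ≤ y → x ^ℚ k ≤ y ^ℚ k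
^ℚ-monoˡ-≤ zero    0≤x x≤y = ℚP.≤-refl
^ℚ-monoˡ-≤ (suc k) 0≤x x≤y = *-mono-≤-0≤ 0≤x (^ℚ-nonNeg k 0≤x) x≤y (^ℚ-monoˡ-≤ k 0≤x x≤y)

^ℚ-≤1 : ∀ {x} k → 0ℚ ≤ x → x ≤ 1ℚ → x ^ℚ k ≤ 1ℚ
^ℚ-≤1 k 0≤x x≤1 = ℚP.≤-trans (^ℚ-monoˡ-≤ k 0≤x x≤1) (ℚP.≤-reflexive (1^k k))
  where
  1^k : ∀ k → 1ℚ ^ℚ k ≡ 1ℚ
  1^k zero    = refl
  1^k (suc k) = trans (ℚP.*-identityˡ _) (1^k k)

-- Finite sums

sumTo : (ℕ → ℚ) → ℕ → ℚ
sumTo f K = sumℚ (applyUpTo f K)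

sumTo-cong : ∀ {f g} K → (∀ j → f j ≡ g j) → sumTo f K ≡ sumTo g K
sumTo-cong zero    f≗g = refl
sumTo-cong (suc K) f≗g = cong₂ _+_ (f≗g 0) (sumTo-cong K (f≗g ∘ suc))

*-distribˡ-sumTo : ∀ c f K → c * sumTo f K ≡ sumTo (λ j → c * f j) K
*-distribˡ-sumTo c f zero    = ℚP.*-zeroʳ c
*-distribˡ-sumTo c f (suc K) =
  trans (ℚP.*-distribˡ-+ c (f 0) _) (cong (_+_ (c * f 0)) (*-distribˡ-sumTo c (f ∘ suc) K))

sumTo-+ : ∀ f g K → sumTo (λ j → f j + g j) K ≡ sumTo f K + sumTo g K
sumTo-+ f g zero    = refl
sumTo-+ f g (suc K) =
  trans (cong (_+_ (f 0 + g 0)) (sumTo-+ (f ∘ suc) (g ∘ suc) K)) (interchange (f 0) (g 0) _ _)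
  where
  open ℚS
  interchange : ∀ a b c d → a + b + (c + d) ≡ a + c + (b + d)
  interchange = solve 4 (λ a b c d → a :+ b :+ (c :+ d) := a :+ c :+ (b :+ d)) refl

sumTo-mono-≤ : ∀ {f g} K → (∀ j → j ℕ.< K → f j ≤ g j) → sumTo f K ≤ sumTo g K
sumTo-mono-≤ zero    f≤g = ℚP.≤-refl
sumTo-mono-≤ (suc K) f≤g = ℚP.+-mono-≤ (f≤g 0 (s≤s z≤n)) (sumTo-mono-≤ K (λ j j<K → f≤g (suc j) (s≤s j<K)))

sumTo-const : ∀ c K → sumTo (λ _ → c) K ≡ fromℕ K * c
sumTo-const c zero    = sym (ℚP.*-zeroˡ c)
sumTo-const c (suc K) = begin
  c + sumTo (λ _ → c) K      ≡⟨ cong₂ _+_ (sym (ℚP.*-identityˡ c)) (sumTo-const c K) ⟩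
  1ℚ * c + fromℕ K * c       ≡⟨ ℚP.*-distribʳ-+ c 1ℚ (fromℕ K) ⟨
  (1ℚ + fromℕ K) * c         ≡⟨ cong (_* c) (fromℕ-+ 1 K) ⟨
  fromℕ (suc K) * c          ∎
  where open ≡-Reasoning

sumℚ-++ : ∀ (xs ys : List ℚ) → sumℚ (xs ++ ys) ≡ sumℚ xs + sumℚ ys
sumℚ-++ []       ys = sym (ℚP.+-identityˡ _)
sumℚ-++ (x ∷ xs) ys = trans (cong (_+_ x) (sumℚ-++ xs ys)) (sym (ℚP.+-assoc x _ _))

sumℚ-concat : ∀ (xss : List (List ℚ)) → sumℚ (concat xss) ≡ sumℚ (map sumℚ xss)
sumℚ-concat []         = refl
sumℚ-concat (xs ∷ xss) = trans (sumℚ-++ xs (concat xss)) (cong (_+_ (sumℚ xs)) (sumℚ-concat xss))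

sumℚ-map-*ˡ : ∀ {A : Set} c (f : A → ℚ) xs → sumℚ (map (λ x → c * f x) xs) ≡ c * sumℚ (map f xs)
sumℚ-map-*ˡ c f []       = sym (ℚP.*-zeroʳ c)
sumℚ-map-*ˡ c f (x ∷ xs) = trans (cong (_+_ (c * f x)) (sumℚ-map-*ˡ c f xs)) (sym (ℚP.*-distribˡ-+ c (f x) _))

sumℚ-box-suc : ∀ {m} (f : Vec ℕ (suc m) → ℚ) M →
  sumℚ (map f (box (suc m) M)) ≡ sumTo (λ j → sumℚ (map (f ∘ (j ∷_)) (box m M))) (suc M)
sumℚ-box-suc {m} f M = begin
  sumℚ (map f (concat (map rows (applyUpTo (λ j → j) (suc M)))))
    ≡⟨ cong sumℚ (ListP.map-concatMap f rows (applyUpTo (λ j → j) (suc M))) ⟩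
  sumℚ (concat (map (map f ∘ rows) (applyUpTo (λ j → j) (suc M))))
    ≡⟨ sumℚ-concat (map (map f ∘ rows) (applyUpTo (λ j → j) (suc M))) ⟩
  sumℚ (map sumℚ (map (map f ∘ rows) (applyUpTo (λ j → j) (suc M))))
    ≡⟨ cong sumℚ (ListP.map-∘ {g = sumℚ} {f = map f ∘ rows} (applyUpTo (λ j → j) (suc M))) ⟨
  sumℚ (map (sumℚ ∘ map f ∘ rows) (applyUpTo (λ j → j) (suc M)))
    ≡⟨ cong sumℚ (ListP.map-applyUpTo (λ j → j) (sumℚ ∘ map f ∘ rows) (suc M)) ⟩
  sumTo (λ j → sumℚ (map f (map (j ∷_) (box m M)))) (suc M)
    ≡⟨ sumTo-cong (suc M) (λ j → cong sumℚ (ListP.map-∘ {g = f} {f = j ∷_} (box m M))) ⟨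
  sumTo (λ j → sumℚ (map (f ∘ (j ∷_)) (box m M))) (suc M) ∎
  where
  open ≡-Reasoning
  rows : ℕ → List (Vec ℕ (suc m))
  rows j = map (j ∷_) (box m M)

telescope : ∀ (y : ℚ) (G G′ : ℕ → ℚ) → (∀ t → G t ≡ fromℕ t * G′ t + y * G (suc t)) →
  ∀ K a → sumTo (λ j → fromℕ (a ℕ.+ j) * y ^ℚ j * G′ (a ℕ.+ j)) K + y ^ℚ K * G (a ℕ.+ K) ≡ G a
telescope y G G′ step zero    a = trans (ℚP.+-identityˡ _) (trans (ℚP.*-identityˡ _) (cong G (ℕP.+-identityʳ a)))
telescope y G G′ step (suc K) a = begin
  summand a 0 + sumTo (summand a ∘ suc) K + y * y ^ℚ K * G (a ℕ.+ suc K)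
    ≡⟨ cong₂ (λ u v → summand a 0 + u + v) (sumTo-cong K shift) (cong (λ b → y * y ^ℚ K * G b) (ℕP.+-suc a K)) ⟩
  summand a 0 + sumTo (λ j → y * summand (suc a) j) K + y * y ^ℚ K * G (suc a ℕ.+ K)
    ≡⟨ cong (λ u → summand a 0 + u + y * y ^ℚ K * G (suc a ℕ.+ K)) (*-distribˡ-sumTo y (summand (suc a)) K) ⟨
  summand a 0 + y * sumTo (summand (suc a)) K + y * y ^ℚ K * G (suc a ℕ.+ K)
    ≡⟨ factor (summand a 0) y (sumTo (summand (suc a)) K) (y ^ℚ K) (G (suc a ℕ.+ K)) ⟩
  summand a 0 + y * (sumTo (summand (suc a)) K + y ^ℚ K * G (suc a ℕ.+ K))
    ≡⟨ cong₂ (λ u v → u + y * v) summand-a-0 (telescope y G G′ step K (suc a)) ⟩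
  fromℕ a * G′ a + y * G (suc a)
    ≡⟨ step a ⟨
  G a ∎
  where
  open ≡-Reasoning
  summand : ℕ → ℕ → ℚ
  summand a j = fromℕ (a ℕ.+ j) * y ^ℚ j * G′ (a ℕ.+ j)
  shift : ∀ j → summand a (suc j) ≡ y * summand (suc a) j
  shift j rewrite ℕP.+-suc a j = rearrange (fromℕ (suc a ℕ.+ j)) y (y ^ℚ j) (G′ (suc a ℕ.+ j))
    where
    open ℚS
    rearrange : ∀ p q r s → p * (q * r) * s ≡ q * (p * r * s)
    rearrange = solve 4 (λ p q r s → p :* (q :* r) :* s := q :* (p :* r :* s)) refl
  summand-a-0 : summand a 0 ≡ fromℕ a * G′ a
  summand-a-0 rewrite ℕP.+-identityʳ a = cong (_* G′ a) (ℚP.*-identityʳ (fromℕ a))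
  factor : ∀ t y s p g → t + y * s + y * p * g ≡ t + y * (s + p * g)
  factor = solve 5 (λ t y s p g → t :+ y :* s :+ y :* p :* g := t :+ y :* (s :+ p :* g)) refl
    where open ℚS

qdiv^*fromℕ : ∀ a b k x → qdiv a b ^ℚ k * fromℕ x ≡ qdiv (a ℕ.^ k ℕ.* x) (b ℕ.^ k)
qdiv^*fromℕ a b k x = begin
  qdiv a b ^ℚ k * fromℕ x                           ≡⟨ cong (λ q → q ^ℚ k * fromℕ x) (qdiv≡fromℕ*recip a b) ⟩
  (fromℕ a * recip b) ^ℚ k * fromℕ x                ≡⟨ cong (_* fromℕ x) (^ℚ-distrib-* (fromℕ a) (recip b) k) ⟩
  fromℕ a ^ℚ k * recip b ^ℚ k * fromℕ x             ≡⟨ cong₂ (λ u v → u * v * fromℕ x) (fromℕ-^ a k) (recip-^ b k) ⟨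
  fromℕ (a ℕ.^ k) * recip (b ℕ.^ k) * fromℕ x       ≡⟨ swap (fromℕ (a ℕ.^ k)) (recip (b ℕ.^ k)) (fromℕ x) ⟩
  fromℕ (a ℕ.^ k) * fromℕ x * recip (b ℕ.^ k)       ≡⟨ cong (_* recip (b ℕ.^ k)) (fromℕ-* (a ℕ.^ k) x) ⟨
  fromℕ (a ℕ.^ k ℕ.* x) * recip (b ℕ.^ k)           ≡⟨ qdiv≡fromℕ*recip (a ℕ.^ k ℕ.* x) (b ℕ.^ k) ⟨
  qdiv (a ℕ.^ k ℕ.* x) (b ℕ.^ k)                    ∎
  where
  open ≡-Reasoning
  open ℚS
  swap : ∀ p q r → p * q * r ≡ p * r * q
  swap = solve 3 (λ p q r → p :* q :* r := p :* r :* q) refl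

positive⇒qdiv : ∀ ε → 0ℚ < ε → ∃[ p ] ∃[ q ] ε ≡ qdiv (suc p) (suc q)
positive⇒qdiv ε@(mkℚ (+ suc p) q _) _                 = p , q , sym (ℚP.↥p/↧p≡p ε)
positive⇒qdiv (mkℚ (+ zero) q _)    (ℚ.*<* (ℤ.+<+ ()))
positive⇒qdiv (mkℚ -[1+ _ ] q _)    (ℚ.*<* ())

sandwich⇒∣-∣≤ : ∀ {x y e} → x ≤ y → y ≤ x + e → ∣ x - y ∣ ≤ e
sandwich⇒∣-∣≤ {x} {y} {e} x≤y y≤x+e = begin
  ∣ x - y ∣       ≡⟨ cong ∣_∣ (flip x y) ⟩
  ∣ - (y - x) ∣   ≡⟨ ℚP.∣-p∣≡∣p∣ (y - x) ⟩
  ∣ y - x ∣       ≡⟨ ℚP.0≤p⇒∣p∣≡p 0≤y-x ⟩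
  y - x           ≤⟨ ℚP.+-monoˡ-≤ (- x) y≤x+e ⟩
  x + e - x       ≡⟨ cancel x e ⟩
  e               ∎
  where
  open ℚP.≤-Reasoning
  open ℚS
  0≤y-x : 0ℚ ≤ y - x
  0≤y-x = ℚP.≤-trans (ℚP.≤-reflexive (sym (ℚP.+-inverseʳ x))) (ℚP.+-monoˡ-≤ (- x) x≤y)
  flip : ∀ x y → x - y ≡ - (y - x)
  flip = solve 2 (λ x y → x :- y := :- (y :- x)) refl
  cancel : ∀ x e → x + e - x ≡ e
  cancel = solve 2 (λ x e → x :+ e :- x := e) refl

-- The inner sums of the series

module Truncation (c₂ n′ : ℕ) where

  n : ℕ
  n = suc n′

  D : ℕ
  D = c₂ ℕ.+ n

  ratio : ℕ → ℚ
  ratio i = qdiv (c₂ ℕ.+ i) D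

  -- With m = n - i remaining variables and a = c₁ + j₁ + … + j_i, tailSum is the inner sum
  -- truncated at M and closedForm i m a is its exact value G_i(a).
  tailSum : (i a m M : ℕ) → ℚ
  tailSum i a m M = sumℚ (map (termAux c₂ n a i) (box m M))

  closedForm : (i m t : ℕ) → ℚ
  closedForm i m t = fromℕ (D ℕ.^ m ℕ.* rising m (t ℕ.+ (c₂ ℕ.+ i))) * recip (m !)

  weight : (i a j : ℕ) → ℚ
  weight i a j = fromℕ (a ℕ.+ j) * ratio i ^ℚ j

  tailSum-suc : ∀ i a m M →
    tailSum i a (suc m) M ≡ sumTo (λ j → weight i a j * tailSum (suc i) (a ℕ.+ j) m M) (suc M)
  tailSum-suc i a m M = trans (sumℚ-box-suc {m} (termAux c₂ n a i) M) (sumTo-cong (suc M) λ j →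
    sumℚ-map-*ˡ (weight i a j) (termAux c₂ n (a ℕ.+ j) (suc i)) (box m M))

  recip*fromℕ-D : recip D * fromℕ D ≡ 1ℚ
  recip*fromℕ-D = subst (λ d → recip d * fromℕ d ≡ 1ℚ) (sym (ℕP.+-suc c₂ n′)) (recip*fromℕ (c₂ ℕ.+ n′))

  D≡c₂+i+m : ∀ {i m} → i ℕ.+ m ≡ n → D ≡ c₂ ℕ.+ i ℕ.+ m
  D≡c₂+i+m {i} {m} i+m≡n = trans (cong (c₂ ℕ.+_) (sym i+m≡n)) (sym (ℕP.+-assoc c₂ i m))

  shift-index : ∀ {i m} → i ℕ.+ suc m ≡ n → suc i ℕ.+ m ≡ n
  shift-index {i} {m} = trans (sym (ℕP.+-suc i m))

  index-≤ : ∀ {i m} → i ℕ.+ suc m ≡ n → i ℕ.≤ n′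
  index-≤ {i} {m} i+1+m≡n = ℕP.≤-trans (ℕP.m≤m+n i m) (ℕP.≤-reflexive (ℕP.suc-injective (shift-index i+1+m≡n)))

  closedForm-recurrence : ∀ i m → i ℕ.+ suc m ≡ n → ∀ t →
    closedForm i (suc m) t ≡ fromℕ t * closedForm (suc i) m t + ratio i * closedForm i (suc m) (suc t)
  closedForm-recurrence i m i+1+m≡n t = begin
    closedForm i (suc m) t
      ≡⟨ cong (λ a → fromℕ a * recip (suc m !)) (regroup D (D ℕ.^ m) x (rising m (suc x))) ⟩
    fromℕ (D ℕ.* x ℕ.* P) * recip (suc m !)
      ≡⟨ trans (cong (_* recip (suc m !)) (fromℕ-* (D ℕ.* x) P)) (ℚP.*-assoc (fromℕ (D ℕ.* x)) (fromℕ P) _) ⟩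
    fromℕ (D ℕ.* x) * Q
      ≡⟨ cong (λ a → fromℕ a * Q) (trans (cong (ℕ._* x) D≡u+1+m) (split t u m)) ⟩
    fromℕ (t ℕ.* suc m ℕ.+ u ℕ.* (x ℕ.+ suc m)) * Q
      ≡⟨ cong (_* Q) (trans (fromℕ-+ (t ℕ.* suc m) _) (cong₂ _+_ (fromℕ-* t (suc m)) (fromℕ-* u (x ℕ.+ suc m)))) ⟩
    (fromℕ t * fromℕ (suc m) + fromℕ u * fromℕ (x ℕ.+ suc m)) * Q
      ≡⟨ distribute (fromℕ t) (fromℕ (suc m)) (fromℕ u) (fromℕ (x ℕ.+ suc m)) Q ⟩
    fromℕ t * (fromℕ (suc m) * Q) + fromℕ u * (fromℕ (x ℕ.+ suc m) * Q)
      ≡⟨ cong₂ (λ a b → fromℕ t * a + b) lower-index shifted ⟨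
    fromℕ t * closedForm (suc i) m t + ratio i * closedForm i (suc m) (suc t) ∎
    where
    open ≡-Reasoning
    u = c₂ ℕ.+ i
    x = t ℕ.+ u
    P = D ℕ.^ m ℕ.* rising m (suc x)
    Q = fromℕ P * recip (suc m !)
    D≡u+1+m : D ≡ u ℕ.+ suc m
    D≡u+1+m = D≡c₂+i+m i+1+m≡n
    regroup : ∀ d p x r → d ℕ.* p ℕ.* (x ℕ.* r) ≡ d ℕ.* x ℕ.* (p ℕ.* r)
    regroup = solve-∀
    split : ∀ t u m → (u ℕ.+ suc m) ℕ.* (t ℕ.+ u) ≡ t ℕ.* suc m ℕ.+ u ℕ.* (t ℕ.+ u ℕ.+ suc m)
    split = solve-∀
    distribute : ∀ a b c d q → (a * b + c * d) * q ≡ a * (b * q) + c * (d * q)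
    distribute = solve 5 (λ a b c d q → (a :* b :+ c :* d) :* q := a :* (b :* q) :+ c :* (d :* q)) refl
      where open ℚS
    lower-index : closedForm (suc i) m t ≡ fromℕ (suc m) * Q
    lower-index = begin
      fromℕ (D ℕ.^ m ℕ.* rising m (t ℕ.+ (c₂ ℕ.+ suc i))) * recip (m !)
        ≡⟨ cong (λ y → fromℕ (D ℕ.^ m ℕ.* rising m y) * recip (m !)) (trans (cong (t ℕ.+_) (ℕP.+-suc c₂ i)) (ℕP.+-suc t u)) ⟩
      fromℕ P * recip (m !)
        ≡⟨ cong (fromℕ P *_) (recip-! m) ⟩
      fromℕ P * (fromℕ (suc m) * recip (suc m !))
        ≡⟨ ℚS.solve 3 (λ p s r → p ℚS.:* (s ℚS.:* r) ℚS.:= s ℚS.:* (p ℚS.:* r)) refl (fromℕ P) (fromℕ (suc m)) (recip (suc m !)) ⟩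
      fromℕ (suc m) * Q ∎
    shifted : ratio i * closedForm i (suc m) (suc t) ≡ fromℕ u * (fromℕ (x ℕ.+ suc m) * Q)
    shifted = begin
      ratio i * (fromℕ (D ℕ.* D ℕ.^ m ℕ.* rising (suc m) (suc x)) * recip (suc m !))
        ≡⟨ cong₂ (λ a b → a * (fromℕ b * recip (suc m !))) (qdiv≡fromℕ*recip u D) numerator ⟩
      fromℕ u * recip D * (fromℕ (D ℕ.* ((x ℕ.+ suc m) ℕ.* P)) * recip (suc m !))
        ≡⟨ cong (λ a → fromℕ u * recip D * (a * recip (suc m !)))
             (trans (fromℕ-* D _) (cong (fromℕ D *_) (fromℕ-* (x ℕ.+ suc m) P))) ⟩
      fromℕ u * recip D * (fromℕ D * (fromℕ (x ℕ.+ suc m) * fromℕ P) * recip (suc m !))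
        ≡⟨ ℚS.solve 6 (λ a b c d e f → a ℚS.:* b ℚS.:* (c ℚS.:* (d ℚS.:* e) ℚS.:* f) ℚS.:= a ℚS.:* (b ℚS.:* c) ℚS.:* (d ℚS.:* (e ℚS.:* f))) refl
             (fromℕ u) (recip D) (fromℕ D) (fromℕ (x ℕ.+ suc m)) (fromℕ P) (recip (suc m !)) ⟩
      fromℕ u * (recip D * fromℕ D) * (fromℕ (x ℕ.+ suc m) * Q)
        ≡⟨ cong (λ a → fromℕ u * a * (fromℕ (x ℕ.+ suc m) * Q)) recip*fromℕ-D ⟩
      fromℕ u * 1ℚ * (fromℕ (x ℕ.+ suc m) * Q)
        ≡⟨ cong (_* (fromℕ (x ℕ.+ suc m) * Q)) (ℚP.*-identityʳ (fromℕ u)) ⟩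
      fromℕ u * (fromℕ (x ℕ.+ suc m) * Q) ∎
      where
      numerator : D ℕ.* D ℕ.^ m ℕ.* rising (suc m) (suc x) ≡ D ℕ.* ((x ℕ.+ suc m) ℕ.* P)
      numerator = begin
        D ℕ.* D ℕ.^ m ℕ.* rising (suc m) (suc x)              ≡⟨ cong (D ℕ.* D ℕ.^ m ℕ.*_) (rising-sucˡ m (suc x)) ⟩
        D ℕ.* D ℕ.^ m ℕ.* (rising m (suc x) ℕ.* (suc x ℕ.+ m)) ≡⟨ cong (λ y → D ℕ.* D ℕ.^ m ℕ.* (rising m (suc x) ℕ.* y)) (sym (ℕP.+-suc x m)) ⟩
        D ℕ.* D ℕ.^ m ℕ.* (rising m (suc x) ℕ.* (x ℕ.+ suc m)) ≡⟨ reorder D (D ℕ.^ m) (rising m (suc x)) (x ℕ.+ suc m) ⟩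
        D ℕ.* ((x ℕ.+ suc m) ℕ.* P)                              ∎
        where
        reorder : ∀ d p r y → d ℕ.* p ℕ.* (r ℕ.* y) ≡ d ℕ.* (y ℕ.* (p ℕ.* r))
        reorder = solve-∀

  ratio-nonNeg : ∀ i → 0ℚ ≤ ratio i
  ratio-nonNeg i = subst (0ℚ ≤_) (sym (qdiv≡fromℕ*recip (c₂ ℕ.+ i) D))
    (*-nonNeg (fromℕ-nonNeg (c₂ ℕ.+ i)) (recip-nonNeg D))

  ratio-mono-≤ : ∀ {i j} → i ℕ.≤ j → ratio i ≤ ratio j
  ratio-mono-≤ {i} {j} i≤j = subst₂ _≤_ (sym (qdiv≡fromℕ*recip (c₂ ℕ.+ i) D)) (sym (qdiv≡fromℕ*recip (c₂ ℕ.+ j) D))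
    (*-monoʳ-≤-0≤ (recip-nonNeg D) (fromℕ-mono-≤ (ℕP.+-monoʳ-≤ c₂ i≤j)))

  ratio-≤1 : ∀ {i} → i ℕ.≤ n → ratio i ≤ 1ℚ
  ratio-≤1 {i} i≤n = begin
    ratio i                  ≡⟨ qdiv≡fromℕ*recip (c₂ ℕ.+ i) D ⟩
    fromℕ (c₂ ℕ.+ i) * recip D ≤⟨ *-monoʳ-≤-0≤ (recip-nonNeg D) (fromℕ-mono-≤ (ℕP.+-monoʳ-≤ c₂ i≤n)) ⟩
    fromℕ D * recip D        ≡⟨ trans (ℚP.*-comm (fromℕ D) (recip D)) recip*fromℕ-D ⟩
    1ℚ                       ∎
    where open ℚP.≤-Reasoning

  closedForm-nonNeg : ∀ i m t → 0ℚ ≤ closedForm i m t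
  closedForm-nonNeg i m t = *-nonNeg (fromℕ-nonNeg (D ℕ.^ m ℕ.* rising m (t ℕ.+ (c₂ ℕ.+ i)))) (recip-nonNeg (m !))

  closedForm-≤ : ∀ {i m} → i ℕ.+ m ≡ n → ∀ t → closedForm i m t ≤ fromℕ ((D ℕ.* (t ℕ.+ D)) ℕ.^ m)
  closedForm-≤ {i} {m} i+m≡n t = begin
    fromℕ (D ℕ.^ m ℕ.* rising m (t ℕ.+ (c₂ ℕ.+ i))) * recip (m !)
      ≤⟨ *-monoˡ-≤-0≤ (fromℕ-nonNeg (D ℕ.^ m ℕ.* rising m (t ℕ.+ (c₂ ℕ.+ i)))) (recip-≤1 (m !)) ⟩
    fromℕ (D ℕ.^ m ℕ.* rising m (t ℕ.+ (c₂ ℕ.+ i))) * 1ℚ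
      ≡⟨ ℚP.*-identityʳ _ ⟩
    fromℕ (D ℕ.^ m ℕ.* rising m (t ℕ.+ (c₂ ℕ.+ i)))
      ≤⟨ fromℕ-mono-≤ (ℕP.*-monoʳ-≤ (D ℕ.^ m) (rising≤^ m (t ℕ.+ (c₂ ℕ.+ i)))) ⟩
    fromℕ (D ℕ.^ m ℕ.* (t ℕ.+ (c₂ ℕ.+ i) ℕ.+ m) ℕ.^ m)
      ≡⟨ cong (λ y → fromℕ (D ℕ.^ m ℕ.* y ℕ.^ m)) t+u+m≡t+D ⟩
    fromℕ (D ℕ.^ m ℕ.* (t ℕ.+ D) ℕ.^ m)
      ≡⟨ cong fromℕ (^-distribʳ-* D (t ℕ.+ D) m) ⟨
    fromℕ ((D ℕ.* (t ℕ.+ D)) ℕ.^ m) ∎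
    where
    open ℚP.≤-Reasoning
    t+u+m≡t+D : t ℕ.+ (c₂ ℕ.+ i) ℕ.+ m ≡ t ℕ.+ D
    t+u+m≡t+D = trans (ℕP.+-assoc t (c₂ ℕ.+ i) m) (cong (t ℕ.+_) (sym (D≡c₂+i+m i+m≡n)))

  weight-nonNeg : ∀ i a j → 0ℚ ≤ weight i a j
  weight-nonNeg i a j = *-nonNeg (fromℕ-nonNeg (a ℕ.+ j)) (^ℚ-nonNeg j (ratio-nonNeg i))

  weight-≤ : ∀ {i} → i ℕ.≤ n → ∀ a j → weight i a j ≤ fromℕ (a ℕ.+ j)
  weight-≤ {i} i≤n a j = ℚP.≤-trans (*-monoˡ-≤-0≤ (fromℕ-nonNeg (a ℕ.+ j)) (^ℚ-≤1 j (ratio-nonNeg i) (ratio-≤1 i≤n)))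
    (ℚP.≤-reflexive (ℚP.*-identityʳ (fromℕ (a ℕ.+ j))))

  tailSum≤closedForm : ∀ m i → i ℕ.+ m ≡ n → ∀ a M → tailSum i a m M ≤ closedForm i m a
  tailSum≤closedForm zero    i i+m≡n a M = ℚP.≤-refl
  tailSum≤closedForm (suc m) i i+m≡n a M = begin
    tailSum i a (suc m) M
      ≡⟨ tailSum-suc i a m M ⟩
    sumTo (λ j → weight i a j * tailSum (suc i) (a ℕ.+ j) m M) K
      ≤⟨ sumTo-mono-≤ K (λ j _ → *-monoˡ-≤-0≤ (weight-nonNeg i a j)
           (tailSum≤closedForm m (suc i) (shift-index i+m≡n) (a ℕ.+ j) M)) ⟩
    sumTo (λ j → weight i a j * closedForm (suc i) m (a ℕ.+ j)) K
      ≤⟨ p≤p+q (*-nonNeg (^ℚ-nonNeg K (ratio-nonNeg i)) (closedForm-nonNeg i (suc m) (a ℕ.+ K))) ⟩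
    sumTo (λ j → weight i a j * closedForm (suc i) m (a ℕ.+ j)) K + ratio i ^ℚ K * closedForm i (suc m) (a ℕ.+ K)
      ≡⟨ telescope (ratio i) (closedForm i (suc m)) (closedForm (suc i) m) (closedForm-recurrence i m i+m≡n) K a ⟩
    closedForm i (suc m) a ∎
    where
    open ℚP.≤-Reasoning
    K = suc M

  z : ℚ
  z = ratio n′

  reach : (m a M : ℕ) → ℕ
  reach m a M = a ℕ.+ m ℕ.* suc M ℕ.+ D

  -- The exponent 3m is crude, but it is what lets the induction step close (^-absorb-step).
  errorBound : (m a M : ℕ) → ℕ
  errorBound m a M = (D ℕ.* reach m a M) ℕ.^ (3 ℕ.* m)

  weighted-errorBound-≤ : ∀ m a M j → j ℕ.≤ suc M → let V = reach (suc m) a M in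
    (a ℕ.+ j) ℕ.* errorBound m (a ℕ.+ j) M ℕ.≤ V ℕ.* (D ℕ.* V) ℕ.^ (3 ℕ.* m)
  weighted-errorBound-≤ m a M j j≤K = ℕP.*-mono-≤
    (ℕP.≤-trans (ℕP.m≤m+n (a ℕ.+ j) (m ℕ.* suc M ℕ.+ D))
      (ℕP.≤-trans (ℕP.≤-reflexive (sym (ℕP.+-assoc (a ℕ.+ j) (m ℕ.* suc M) D))) reach≤V))
    (ℕP.^-monoˡ-≤ (3 ℕ.* m) (ℕP.*-monoʳ-≤ D reach≤V))
    where
    reach≤V : reach m (a ℕ.+ j) M ℕ.≤ reach (suc m) a M
    reach≤V = ℕP.+-monoˡ-≤ D (ℕP.≤-trans (ℕP.≤-reflexive (ℕP.+-assoc a j (m ℕ.* suc M)))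
      (ℕP.+-monoʳ-≤ a (ℕP.+-monoˡ-≤ (m ℕ.* suc M) j≤K)))

  1≤D : 1 ℕ.≤ D
  1≤D = ℕP.≤-trans (s≤s z≤n) (ℕP.m≤n+m n c₂)

  errorBound-suc : ∀ m a M → let V = reach (suc m) a M in
    (D ℕ.* V) ℕ.^ suc m ℕ.+ suc M ℕ.* (V ℕ.* (D ℕ.* V) ℕ.^ (3 ℕ.* m)) ℕ.≤ errorBound (suc m) a M
  errorBound-suc m a M = ^-absorb-step D V K m 1≤D D≤V K≤V 2≤V
    where
    K = suc M
    V = reach (suc m) a M
    K≤a+[1+m]K : K ℕ.≤ a ℕ.+ suc m ℕ.* K
    K≤a+[1+m]K = ℕP.≤-trans (ℕP.m≤m+n K (m ℕ.* K)) (ℕP.m≤n+m (suc m ℕ.* K) a)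
    D≤V : D ℕ.≤ V
    D≤V = ℕP.m≤n+m D (a ℕ.+ suc m ℕ.* K)
    K≤V : K ℕ.≤ V
    K≤V = ℕP.≤-trans K≤a+[1+m]K (ℕP.m≤m+n _ D)
    2≤V : 2 ℕ.≤ V
    2≤V = ℕP.+-mono-≤ (ℕP.≤-trans (s≤s z≤n) K≤a+[1+m]K) 1≤D

  weighted-error-≤ : ∀ {i} → i ℕ.≤ n → ∀ m a M j → j ℕ.< suc M → ∀ F → let V = reach (suc m) a M in
    weight i a j * (F + z ^ℚ suc M * fromℕ (errorBound m (a ℕ.+ j) M))
      ≤ weight i a j * F + z ^ℚ suc M * fromℕ (V ℕ.* (D ℕ.* V) ℕ.^ (3 ℕ.* m))
  weighted-error-≤ {i} i≤n m a M j j<K F = begin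
    w * (F + zK * fromℕ E)
      ≡⟨ ℚP.*-distribˡ-+ w F (zK * fromℕ E) ⟩
    w * F + w * (zK * fromℕ E)
      ≤⟨ ℚP.+-monoʳ-≤ (w * F) (*-monoʳ-≤-0≤ (*-nonNeg zK-nonNeg (fromℕ-nonNeg E)) (weight-≤ i≤n a j)) ⟩
    w * F + fromℕ (a ℕ.+ j) * (zK * fromℕ E)
      ≡⟨ cong (_+_ (w * F)) (trans (swap (fromℕ (a ℕ.+ j)) zK (fromℕ E)) (cong (zK *_) (sym (fromℕ-* (a ℕ.+ j) E)))) ⟩
    w * F + zK * fromℕ ((a ℕ.+ j) ℕ.* E)
      ≤⟨ ℚP.+-monoʳ-≤ (w * F) (*-monoˡ-≤-0≤ zK-nonNeg (fromℕ-mono-≤ (weighted-errorBound-≤ m a M j (ℕP.<⇒≤ j<K)))) ⟩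
    w * F + zK * fromℕ (reach (suc m) a M ℕ.* (D ℕ.* reach (suc m) a M) ℕ.^ (3 ℕ.* m)) ∎
    where
    open ℚP.≤-Reasoning
    w = weight i a j
    zK = z ^ℚ suc M
    E = errorBound m (a ℕ.+ j) M
    zK-nonNeg : 0ℚ ≤ zK
    zK-nonNeg = ^ℚ-nonNeg (suc M) (ratio-nonNeg n′)
    swap : ∀ x y w → x * (y * w) ≡ y * (x * w)
    swap = ℚS.solve 3 (λ x y w → x ℚS.:* (y ℚS.:* w) ℚS.:= y ℚS.:* (x ℚS.:* w)) refl

  remainder-≤ : ∀ i m → i ℕ.+ suc m ≡ n → ∀ a M →
    ratio i ^ℚ suc M * closedForm i (suc m) (a ℕ.+ suc M) ≤ z ^ℚ suc M * fromℕ ((D ℕ.* reach (suc m) a M) ℕ.^ suc m)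
  remainder-≤ i m i+m≡n a M = *-mono-≤-0≤ (^ℚ-nonNeg K (ratio-nonNeg i)) (closedForm-nonNeg i (suc m) (a ℕ.+ K))
    (^ℚ-monoˡ-≤ K (ratio-nonNeg i) (ratio-mono-≤ (index-≤ i+m≡n)))
    (ℚP.≤-trans (closedForm-≤ {i} {suc m} i+m≡n (a ℕ.+ K))
      (fromℕ-mono-≤ (ℕP.^-monoˡ-≤ (suc m) (ℕP.*-monoʳ-≤ D (ℕP.+-monoˡ-≤ D (ℕP.+-monoʳ-≤ a (ℕP.m≤m+n K (m ℕ.* K))))))))
    where
    K = suc M

  closedForm≤tailSum+error : ∀ m i → i ℕ.+ m ≡ n → ∀ a M →
    closedForm i m a ≤ tailSum i a m M + z ^ℚ suc M * fromℕ (errorBound m a M)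
  closedForm≤tailSum+error zero    i i+m≡n a M =
    p≤p+q {tailSum i a 0 M} (*-nonNeg (^ℚ-nonNeg (suc M) (ratio-nonNeg n′)) (fromℕ-nonNeg 1))
  closedForm≤tailSum+error (suc m) i i+m≡n a M = begin
    closedForm i (suc m) a
      ≡⟨ telescope (ratio i) (closedForm i (suc m)) (closedForm (suc i) m) (closedForm-recurrence i m i+m≡n) K a ⟨
    sumTo (λ j → weight i a j * closedForm (suc i) m (a ℕ.+ j)) K + ratio i ^ℚ K * closedForm i (suc m) (a ℕ.+ K)
      ≤⟨ ℚP.+-mono-≤ (sumTo-mono-≤ K term-≤) (remainder-≤ i m i+m≡n a M) ⟩
    sumTo (λ j → weight i a j * F′ j + zK * fromℕ W) K + zK * fromℕ R
      ≡⟨ cong (_+ zK * fromℕ R)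
           (trans (sumTo-+ (λ j → weight i a j * F′ j) (λ _ → zK * fromℕ W) K)
                  (cong₂ _+_ (sym (tailSum-suc i a m M)) (sumTo-const (zK * fromℕ W) K))) ⟩
    tailSum i a (suc m) M + fromℕ K * (zK * fromℕ W) + zK * fromℕ R
      ≡⟨ collect (tailSum i a (suc m) M) (fromℕ K) zK (fromℕ W) (fromℕ R) ⟩
    tailSum i a (suc m) M + zK * (fromℕ R + fromℕ K * fromℕ W)
      ≡⟨ cong (λ e → tailSum i a (suc m) M + zK * e)
           (trans (cong (_+_ (fromℕ R)) (sym (fromℕ-* K W))) (sym (fromℕ-+ R (K ℕ.* W)))) ⟩
    tailSum i a (suc m) M + zK * fromℕ (R ℕ.+ K ℕ.* W)
      ≤⟨ ℚP.+-monoʳ-≤ (tailSum i a (suc m) M)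
           (*-monoˡ-≤-0≤ (^ℚ-nonNeg K (ratio-nonNeg n′)) (fromℕ-mono-≤ (errorBound-suc m a M))) ⟩
    tailSum i a (suc m) M + zK * fromℕ (errorBound (suc m) a M) ∎
    where
    open ℚP.≤-Reasoning
    K = suc M
    V = reach (suc m) a M
    R = (D ℕ.* V) ℕ.^ suc m
    W = V ℕ.* (D ℕ.* V) ℕ.^ (3 ℕ.* m)
    zK = z ^ℚ K
    F′ : ℕ → ℚ
    F′ j = tailSum (suc i) (a ℕ.+ j) m M
    term-≤ : ∀ j → j ℕ.< K → weight i a j * closedForm (suc i) m (a ℕ.+ j) ≤ weight i a j * F′ j + zK * fromℕ W
    term-≤ j j<K = ℚP.≤-trans
      (*-monoˡ-≤-0≤ (weight-nonNeg i a j) (closedForm≤tailSum+error m (suc i) (shift-index i+m≡n) (a ℕ.+ j) M))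
      (weighted-error-≤ (ℕP.m≤n⇒m≤1+n (index-≤ i+m≡n)) m a M j j<K (F′ j))
    collect : ∀ t k z w r → t + k * (z * w) + z * r ≡ t + z * (r + k * w)
    collect = ℚS.solve 5 (λ t k z w r → t ℚS.:+ k ℚS.:* (z ℚS.:* w) ℚS.:+ z ℚS.:* r ℚS.:= t ℚS.:+ z ℚS.:* (r ℚS.:+ k ℚS.:* w)) refl

  errorBound-≤-poly : ∀ m a M → errorBound m a M ℕ.≤ (D ℕ.* (a ℕ.+ m ℕ.+ D)) ℕ.^ (3 ℕ.* m) ℕ.* suc M ℕ.^ (3 ℕ.* m)
  errorBound-≤-poly m a M = begin
    (D ℕ.* reach m a M) ℕ.^ (3 ℕ.* m)          ≤⟨ ℕP.^-monoˡ-≤ (3 ℕ.* m) (ℕP.*-monoʳ-≤ D reach≤) ⟩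
    (D ℕ.* ((a ℕ.+ m ℕ.+ D) ℕ.* K)) ℕ.^ (3 ℕ.* m) ≡⟨ cong (ℕ._^ (3 ℕ.* m)) (sym (ℕP.*-assoc D (a ℕ.+ m ℕ.+ D) K)) ⟩
    (D ℕ.* (a ℕ.+ m ℕ.+ D) ℕ.* K) ℕ.^ (3 ℕ.* m)   ≡⟨ ^-distribʳ-* (D ℕ.* (a ℕ.+ m ℕ.+ D)) K (3 ℕ.* m) ⟩
    (D ℕ.* (a ℕ.+ m ℕ.+ D)) ℕ.^ (3 ℕ.* m) ℕ.* K ℕ.^ (3 ℕ.* m) ∎
    where
    open ℕP.≤-Reasoning
    K = suc M
    reach≤ : reach m a M ℕ.≤ (a ℕ.+ m ℕ.+ D) ℕ.* K
    reach≤ = begin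
      a ℕ.+ m ℕ.* K ℕ.+ D                  ≤⟨ ℕP.+-mono-≤ (ℕP.+-monoˡ-≤ (m ℕ.* K) (ℕP.m≤m*n a K)) (ℕP.m≤m*n D K) ⟩
      a ℕ.* K ℕ.+ m ℕ.* K ℕ.+ D ℕ.* K      ≡⟨ distrib a m D K ⟩
      (a ℕ.+ m ℕ.+ D) ℕ.* K                ∎
      where
      distrib : ∀ a m d k → a ℕ.* k ℕ.+ m ℕ.* k ℕ.+ d ℕ.* k ≡ (a ℕ.+ m ℕ.+ d) ℕ.* k
      distrib = solve-∀

rhs≡closedForm : ∀ n′ c₁ c₂ → rhs (suc n′) c₁ c₂ ≡ Truncation.closedForm c₂ n′ 0 (suc n′) c₁
rhs≡closedForm n′ c₁ c₂ = trans (qdiv≡fromℕ*recip _ (n !))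
  (cong (λ r → fromℕ ((c₂ ℕ.+ n) ℕ.^ n ℕ.* r) * recip (n !))
    (trans (cong product (ListP.map-applyUpTo (λ k → k) (λ k → c₁ ℕ.+ c₂ ℕ.+ k) n))
           (product-applyUpTo≡rising n (c₁ ℕ.+ (c₂ ℕ.+ 0)) (λ k → c₁ ℕ.+ c₂ ℕ.+ k)
             (λ k → cong (λ c → c₁ ℕ.+ c ℕ.+ k) (sym (ℕP.+-identityʳ c₂))))))
  where
  n = suc n′

lemma2p3 : (n c₁ c₂ : ℕ) → 1 ℕ.≤ n →
    (ε : ℚ) → 0ℚ < ε →
      ∃[ N ] ((M : ℕ) → N ℕ.≤ M → ∣ partialSum n c₁ c₂ M - rhs n c₁ c₂ ∣ < ε)
lemma2p3 zero     c₁ c₂ () ε 0<ε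
lemma2p3 (suc n′) c₁ c₂ _  ε 0<ε with positive⇒qdiv ε 0<ε
... | p , q , refl = N , λ M N≤M → begin-strict
  ∣ tailSum 0 c₁ n M - rhs n c₁ c₂ ∣
    ≡⟨ cong (λ r → ∣ tailSum 0 c₁ n M - r ∣) (rhs≡closedForm n′ c₁ c₂) ⟩
  ∣ tailSum 0 c₁ n M - closedForm 0 n c₁ ∣
    ≤⟨ sandwich⇒∣-∣≤ (tailSum≤closedForm n 0 refl c₁ M) (closedForm≤tailSum+error n 0 refl c₁ M) ⟩
  z ^ℚ suc M * fromℕ (errorBound n c₁ M)
    ≤⟨ *-monoˡ-≤-0≤ (^ℚ-nonNeg (suc M) (ratio-nonNeg n′)) (fromℕ-mono-≤ (errorBound-≤-poly n c₁ M)) ⟩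
  z ^ℚ suc M * fromℕ (C ℕ.* suc M ℕ.^ e)
    ≡⟨ qdiv^*fromℕ d D (suc M) (C ℕ.* suc M ℕ.^ e) ⟩
  qdiv (d ℕ.^ suc M ℕ.* (C ℕ.* suc M ℕ.^ e)) (D ℕ.^ suc M)
    <⟨ qdiv-<-qdiv _ (D ℕ.^ suc M) (suc p) q (subst (λ b → 1 ℕ.≤ b ℕ.^ suc M) (sym D≡1+d) (ℕP.m^n>0 (suc d) (suc M)))
         (subst (λ b → d ℕ.^ suc M ℕ.* (C ℕ.* suc M ℕ.^ e) ℕ.* suc q ℕ.< suc p ℕ.* b ℕ.^ suc M) (sym D≡1+d)
           (dominated (suc M) (ℕP.m≤n⇒m≤1+n N≤M))) ⟩
  qdiv (suc p) (suc q) ∎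
  where
  open Truncation c₂ n′
  open ℚP.≤-Reasoning
  d = c₂ ℕ.+ n′
  D≡1+d : D ≡ suc d
  D≡1+d = ℕP.+-suc c₂ n′
  e = 3 ℕ.* n
  C = (D ℕ.* (c₁ ℕ.+ n ℕ.+ D)) ℕ.^ e
  N = proj₁ (^-dominates-poly d C e p q)
  dominated = proj₂ (^-dominates-poly d C e p q)
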